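{- Let $n\ge1$ and let $\mathcal{N}\in A_n$ be a topdrop-valid necklace in $S_n$. Then the number of distinct orbits of the topdrop map in $S_n$ whose topdrop-necklace is $\mathcal{N}$ equals $$\frac{\bigl(n-d(\mathcal{N})\bigr)!}{P(\mathcal{N})},$$ where $d(\mathcal{N})$ is the number of distinct values appearing in $\mathcal{N}$.
   Context: Permutations are in one-line notation $\pi=\pi_1\cdots\pi_n$. The topdrop map $T:S_n\to S_n$ is $T(\pi_1\cdots\pi_n)=\pi_{\pi_1+1}\cdots\pi_n\,\pi_{\pi_1}\pi_{\pi_1-1}\cdots\pi_1$ (first $\pi_1$ entries removed, reversed, appended at the end); it is a bijection. The orbit of $\pi$ is $(\pi,T(\pi),\dots,T^{s-1}(\pi))$ with $s\ge1$ minimal such that $T^s(\pi)=\pi$. The topdrop-necklace of $\pi$ (and of its orbit) is the cyclic sequence $[\pi_1,T(\pi)_1,\dots,T^{s-1}(\pi)_1]$, considered up to cyclic rotation; its size is $s$. A necklace is topdrop-valid in $S_n$ if it is the topdrop-necklace of some $\pi\in S_n$; $A_n$ is the set of such necklaces. For a necklace $\mathcal{N}=[x_1,\dots,x_s]$, let $t$ be the length of the shortest contiguous segment which, repeated, forms $\mathcal{N}$ (i.e. the least $t\ge1$ with $x_{i+t}=x_i$ for all $i$, indices mod $s$); the fundamental period is $P(\mathcal{N})=s/t$, the number of copies of that segment needed. -}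

module Defs where

open import Data.Nat using (ℕ; zero; suc; _+_; _*_; _∸_; _≤_; _<_)
open import Data.Nat.DivMod using (_%_)
open import Data.Nat.Properties using (_≟_)
open import Data.List using (List; []; _∷_; _++_; take; drop; reverse; map; length; upTo; deduplicate)
open import Data.List.Relation.Binary.Permutation.Propositional using (_↭_)
open import Data.Product using (Σ; ∃; _×_)
open import Relation.Nullary using (¬_)
open import Data.List.Relation.Unary.All using (All)
open import Data.List.Relation.Unary.Any using (Any)
open import Data.List.Relation.Unary.AllPairs using (AllPairs)
open import Relation.Binary.PropositionalEquality using (_≡_; _≢_)

-- Permutations in one-line notation: lists of naturals.
-- π ∈ S_n  iff  π is a rearrangement of [1, 2, …, n].
InS : ℕ → List ℕ → Set
InS n π = π ↭ map suc (upTo n)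

-- The topdrop map: remove the first π₁ entries, reverse them, append at the end.
-- (On the empty list it is the identity; irrelevant for n ≥ 1.)
topdrop : List ℕ → List ℕ
topdrop [] = []
topdrop (x ∷ xs) = drop x (x ∷ xs) ++ reverse (take x (x ∷ xs))

iter : ℕ → List ℕ → List ℕ
iter zero π = π
iter (suc k) π = topdrop (iter k π)

-- first entry (0 on the empty list, never used for genuine permutations)
first : List ℕ → ℕ
first [] = 0
first (x ∷ _) = x

OrbitSize : List ℕ → ℕ → Set
OrbitSize π s = (1 ≤ s) × (iter s π ≡ π) × (∀ k → 1 ≤ k → k < s → iter k π ≢ π)

firstEntries : List ℕ → ℕ → List ℕ
firstEntries π s = map (λ k → first (iter k π)) (upTo s)

rotate : ℕ → List ℕ → List ℕ
rotate k L = drop k L ++ take k L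

-- M is a cyclic rotation of L (equal as necklaces)
SameNecklace : List ℕ → List ℕ → Set
SameNecklace L M = ∃ λ k → M ≡ rotate k L

-- The topdrop-necklace of π is (represented by) the linear sequence N
HasNecklace : List ℕ → List ℕ → Set
HasNecklace π N = ∃ λ s → OrbitSize π s × SameNecklace (firstEntries π s) N

ValidNecklace : ℕ → List ℕ → Set
ValidNecklace n N = ∃ λ π → InS n π × HasNecklace π N

SameOrbit : List ℕ → List ℕ → Set
SameOrbit π σ = ∃ λ k → iter k π ≡ σ

-- i-th entry of a list (0-based, default 0)
nth : List ℕ → ℕ → ℕ
nth [] _ = 0
nth (x ∷ xs) zero = x
nth (x ∷ xs) (suc i) = nth xs i

nthCyc : List ℕ → ℕ → ℕ
nthCyc [] i = 0
nthCyc (x ∷ xs) i = nth (x ∷ xs) (i % suc (length xs))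

IsPeriod : List ℕ → ℕ → Set
IsPeriod N t = ∀ i → nthCyc N (i + t) ≡ nthCyc N i

LeastPeriod : List ℕ → ℕ → Set
LeastPeriod N t = (1 ≤ t) × IsPeriod N t × (∀ u → 1 ≤ u → u < t → ¬ IsPeriod N u)

-- fundamental period P(N) = s / t  (stated as P * t ≡ s, t the least period)
FundamentalPeriod : List ℕ → ℕ → Set
FundamentalPeriod N p = ∃ λ t → LeastPeriod N t × (p * t ≡ length N)

distinctValues : List ℕ → ℕ
distinctValues N = length (deduplicate _≟_ N)

-- reps is a complete system of representatives (one per orbit) of the topdrop
-- orbits in S_n whose necklace is N; its length is the number of such orbits.
OrbitRepresentatives : ℕ → List ℕ → List (List ℕ) → Set
OrbitRepresentatives n N reps =
  All (λ π → InS n π × HasNecklace π N) reps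
  × AllPairs (λ π σ → ¬ SameOrbit π σ) reps
  × (∀ σ → InS n σ → HasNecklace σ N → Any (λ π → SameOrbit π σ) reps)

{-# OPTIONS --safe #-}
-- Fix π in S_n whose first entries, read from π itself, give N, with orbit size s, and call
-- σ aligned with π when it has the same orbit size and the same sequence of first entries.
-- Running topdrop on π and σ side by side, their positions move identically as long as the
-- first entries agree. As the entries of a permutation are distinct, σ is aligned iff it
-- agrees with π wherever either holds a value of N, i.e. iff σ is π with its n − d other
-- values permuted among themselves: there are (n − d)! aligned permutations. Along an orbit
-- with necklace N, T^k σ is aligned exactly when the least period t of N divides k, so each
-- orbit contains exactly s / t = P aligned permutations, and there are (n − d)! / P orbits.
module Submission where

open import Defs
open import Data.Empty using (⊥-elim)
open import Data.List
  using (List; []; _∷_; _++_; take; drop; reverse; map; length; upTo; applyUpTo; concatMap; filter; zip; deduplicate)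
open import Data.List.Properties
  using ( take++drop≡id; take-all; drop-all; length-applyUpTo; length-map; length-upTo; length-++; map-upTo; map-++
        ; take-map; drop-map; reverse-map; ++-identityʳ; ∷-injectiveˡ; ∷-injectiveʳ; ≡-dec)
open import Data.List.Membership.Propositional using (_∈_; _∉_; find; lose)
open import Data.List.Membership.Propositional.Properties
  using ( ∈-map⁺; ∈-map⁻; ∈-∃++; ∈-concatMap⁺; ∈-concatMap⁻; ∈-filter⁺; ∈-filter⁻
        ; ∈-deduplicate⁺; ∈-deduplicate⁻)
open import Data.List.Membership.Propositional.Properties.WithK using (unique∧set⇒bag)
import Data.List.Membership.DecPropositional as DecMembership
open import Data.List.Relation.Binary.BagAndSetEquality using (∼bag⇒↭)
open import Data.List.Relation.Binary.Permutation.Propositional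
  using (_↭_; ↭-refl; ↭-trans; ↭-sym; ↭-reflexive; prep; swap; ↭⇒↭ₛ)
open import Data.List.Relation.Binary.Permutation.Propositional.Properties
  using ( ++-comm; ++⁺ʳ; ++⁺ˡ; ↭-reverse; ↭-length; ↭-empty-inv; drop-mid; drop-∷; ∈-resp-↭; All-resp-↭
        ; shift; filter-↭)
open import Data.List.Relation.Binary.Permutation.Setoid.Properties using (Unique-resp-↭)
open import Data.List.Relation.Unary.All using (All; []; _∷_)
import Data.List.Relation.Unary.All as All
import Data.List.Relation.Unary.All.Properties as All
open import Data.List.Relation.Unary.AllPairs using (AllPairs; []; _∷_)
import Data.List.Relation.Unary.AllPairs.Properties as AllPairs
open import Data.List.Relation.Unary.Any using (Any; here; there)
import Data.List.Relation.Unary.Any as Any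
open import Data.List.Relation.Unary.Any.Properties using (applyUpTo⁺; applyUpTo⁻)
open import Data.List.Relation.Unary.Unique.Propositional using (Unique)
import Data.List.Relation.Unary.Unique.Propositional.Properties as Unique
open import Data.Nat using (ℕ; zero; suc; _+_; _*_; _∸_; _≤_; _<_; _!; z≤n; s≤s; NonZero)
open import Data.Nat.DivMod using (_%_; _/_; m≡m%n+[m/n]*n; m%n<n)
open import Data.Nat.Divisibility using (_∣_; divides; m%n≡0⇒n∣m)
open import Data.Nat.GeneralisedArithmetic using (fold; fold-+)
open import Data.Nat.Properties
open import Data.List.Relation.Unary.Unique.DecPropositional.Properties _≟_ using (deduplicate-!)
open import Data.Product using (Σ; ∃; _×_; _,_; proj₁; proj₂)
open import Function using (_∘_)
open import Function.Bundles using (mk⇔)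
open import Relation.Binary.Definitions using (DecidableEquality)
open import Relation.Binary.PropositionalEquality
open import Relation.Nullary using (¬_; yes; no; ¬?)
open import Relation.Unary using (Decidable)

private
  variable
    A B : Set

drop++reverse-take-↭ : ∀ k (xs : List A) → drop k xs ++ reverse (take k xs) ↭ xs
drop++reverse-take-↭ k xs =
  ↭-trans (++-comm (drop k xs) (reverse (take k xs)))
    (↭-trans (++⁺ʳ (drop k xs) (↭-reverse (take k xs))) (↭-reflexive (take++drop≡id k xs)))

Unique-resp-↭ˡ : {xs ys : List A} → xs ↭ ys → Unique ys → Unique xs
Unique-resp-↭ˡ {A} p = Unique-resp-↭ (setoid A) (↭⇒↭ₛ (↭-sym p))

map-injectiveOn : (f : A → B) {zs : List A} → Unique (map f zs) →
                  ∀ {x y} → x ∈ zs → y ∈ zs → f x ≡ f y → x ≡ y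
map-injectiveOn f _ (here refl) (here refl) _ = refl
map-injectiveOn f (fz∉ ∷ _) (here refl) (there y∈) e = ⊥-elim (All.lookup fz∉ (∈-map⁺ f y∈) e)
map-injectiveOn f (fz∉ ∷ _) (there x∈) (here refl) e = ⊥-elim (All.lookup fz∉ (∈-map⁺ f x∈) (sym e))
map-injectiveOn f (_ ∷ u) (there x∈) (there y∈) e = map-injectiveOn f u x∈ y∈ e

↭∧map≡⇒≡ : (f : A → B) {xs ys : List A} → xs ↭ ys → Unique (map f ys) → map f xs ≡ map f ys → xs ≡ ys
↭∧map≡⇒≡ f {[]} p _ _ = sym (↭-empty-inv (↭-sym p))
↭∧map≡⇒≡ f {x ∷ xs} {y ∷ ys} p u@(_ ∷ u′) e
  with map-injectiveOn f u (∈-resp-↭ p (here refl)) (here refl) (∷-injectiveˡ e)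
... | refl = cong (x ∷_) (↭∧map≡⇒≡ f (drop-∷ p) u′ (∷-injectiveʳ e))

AllPairs-strengthen : {P : A → Set} {R S : A → A → Set} {xs : List A} →
                      (∀ {x y} → P x → P y → R x y → S x y) → All P xs → AllPairs R xs → AllPairs S xs
AllPairs-strengthen h [] [] = []
AllPairs-strengthen h (px ∷ pxs) (rx ∷ rxs) =
  All.zipWith (λ (py , r) → h px py r) (pxs , rx) ∷ AllPairs-strengthen h pxs rxs

unique-set-↭ : {xs ys : List A} → Unique xs → Unique ys →
               (∀ {x} → x ∈ xs → x ∈ ys) → (∀ {x} → x ∈ ys → x ∈ xs) → xs ↭ ys
unique-set-↭ u v to from = ∼bag⇒↭ (unique∧set⇒bag u v (mk⇔ to from))

applyUpTo-cong : ∀ {f g : ℕ → A} → (∀ i → f i ≡ g i) → ∀ n → applyUpTo f n ≡ applyUpTo g n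
applyUpTo-cong f≗g zero = refl
applyUpTo-cong f≗g (suc n) = cong₂ _∷_ (f≗g 0) (applyUpTo-cong (f≗g ∘ suc) n)

applyUpTo-+ : ∀ (f : ℕ → A) m n → applyUpTo f (m + n) ≡ applyUpTo f m ++ applyUpTo (λ i → f (m + i)) n
applyUpTo-+ f zero n = refl
applyUpTo-+ f (suc m) n = cong (f 0 ∷_) (applyUpTo-+ (f ∘ suc) m n)

take-applyUpTo : ∀ (f : ℕ → A) {k n} → k ≤ n → take k (applyUpTo f n) ≡ applyUpTo f k
take-applyUpTo f z≤n = refl
take-applyUpTo f (s≤s k≤n) = cong (f 0 ∷_) (take-applyUpTo (f ∘ suc) k≤n)

drop-applyUpTo : ∀ (f : ℕ → A) {k n} → k ≤ n → drop k (applyUpTo f n) ≡ applyUpTo (λ i → f (k + i)) (n ∸ k)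
drop-applyUpTo f z≤n = refl
drop-applyUpTo f (s≤s k≤n) = drop-applyUpTo (f ∘ suc) k≤n

nth-applyUpTo : ∀ (f : ℕ → ℕ) {n i} → i < n → nth (applyUpTo f n) i ≡ f i
nth-applyUpTo f {i = zero} (s≤s _) = refl
nth-applyUpTo f {i = suc i} (s≤s i<n) = nth-applyUpTo (f ∘ suc) i<n

applyUpTo-injective : ∀ {f g : ℕ → ℕ} n → applyUpTo f n ≡ applyUpTo g n → ∀ i → i < n → f i ≡ g i
applyUpTo-injective {f} {g} n e _ i<n =
  trans (sym (nth-applyUpTo f i<n)) (trans (cong (λ l → nth l _) e) (nth-applyUpTo g i<n))

map-proj₁-zip : ∀ {xs : List A} {ys : List B} → length xs ≡ length ys → map proj₁ (zip xs ys) ≡ xs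
map-proj₁-zip {xs = []} {[]} _ = refl
map-proj₁-zip {xs = x ∷ xs} {y ∷ ys} e = cong (x ∷_) (map-proj₁-zip (suc-injective e))

map-proj₂-zip : ∀ {xs : List A} {ys : List B} → length xs ≡ length ys → map proj₂ (zip xs ys) ≡ ys
map-proj₂-zip {xs = []} {[]} _ = refl
map-proj₂-zip {xs = x ∷ xs} {y ∷ ys} e = cong (y ∷_) (map-proj₂-zip (suc-injective e))

first-∈ : ∀ {xs : List ℕ} → 1 ≤ length xs → first xs ∈ xs
first-∈ {x ∷ xs} _ = here refl

head-∈ : ∀ {W : List A} {w} → w ∈ W → ∃ λ h → h ∈ W × (∀ (f : A → ℕ) → first (map f W) ≡ f h)
head-∈ {W = h ∷ _} _ = h , here refl , λ _ → refl

-- Periodic sequences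

Period : ℕ → (ℕ → A) → Set
Period u g = ∀ i → g (i + u) ≡ g i

period-* : ∀ {g : ℕ → A} {u} → Period u g → ∀ q → Period (q * u) g
period-* {g = g} per zero i = cong g (+-identityʳ i)
period-* {g = g} {u} per (suc q) i = begin
  g (i + (u + q * u)) ≡⟨ cong g (+-assoc i u (q * u)) ⟨
  g (i + u + q * u)   ≡⟨ period-* per q (i + u) ⟩
  g (i + u)           ≡⟨ per i ⟩
  g i                 ∎
  where open ≡-Reasoning

period-% : ∀ {g : ℕ → A} {u} .{{_ : NonZero u}} → Period u g → ∀ i → g i ≡ g (i % u)
period-% {g = g} {u} per i = begin
  g i                       ≡⟨ cong g (m≡m%n+[m/n]*n i u) ⟩
  g (i % u + (i / u) * u)   ≡⟨ period-* per (i / u) (i % u) ⟩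
  g (i % u)                 ∎
  where open ≡-Reasoning

period-≗ : ∀ {g h : ℕ → A} {u} .{{_ : NonZero u}} → Period u g → Period u h →
           (∀ i → i < u → g i ≡ h i) → ∀ i → g i ≡ h i
period-≗ {u = u} pg ph agree i =
  trans (period-% pg i) (trans (agree (i % u) (m%n<n i u)) (sym (period-% ph i)))

leastPeriod∣period : ∀ {g : ℕ → A} {t j} .{{_ : NonZero t}} → Period t g → (∀ u → 1 ≤ u → u < t → ¬ Period u g) →
                     Period j g → t ∣ j
leastPeriod∣period {g = g} {t} {j} pt least pj with j % t in j%t
... | zero = m%n≡0⇒n∣m j t j%t
... | suc r = ⊥-elim (least (suc r) (s≤s z≤n) (subst (_< t) j%t (m%n<n j t)) remainder-period)
  where
  remainder-period : Period (suc r) g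
  remainder-period i = begin
    g (i + suc r)                   ≡⟨ period-* pt (j / t) (i + suc r) ⟨
    g (i + suc r + (j / t) * t)     ≡⟨ cong g (+-assoc i (suc r) ((j / t) * t)) ⟩
    g (i + (suc r + (j / t) * t))   ≡⟨ cong (λ m → g (i + (m + (j / t) * t))) j%t ⟨
    g (i + (j % t + (j / t) * t))   ≡⟨ cong (λ m → g (i + m)) (m≡m%n+[m/n]*n j t) ⟨
    g (i + j)                       ≡⟨ pj i ⟩
    g i                             ∎
    where open ≡-Reasoning

rotate-applyUpTo : ∀ {g : ℕ → ℕ} {s k} → Period s g → k ≤ s → rotate k (applyUpTo g s) ≡ applyUpTo (λ i → g (k + i)) s
rotate-applyUpTo {g} {s} {k} per k≤s = begin
  drop k (applyUpTo g s) ++ take k (applyUpTo g s)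
    ≡⟨ cong₂ _++_ (drop-applyUpTo g k≤s) (take-applyUpTo g k≤s) ⟩
  applyUpTo g′ (s ∸ k) ++ applyUpTo g k
    ≡⟨ cong (applyUpTo g′ (s ∸ k) ++_) (applyUpTo-cong wrap k) ⟩
  applyUpTo g′ (s ∸ k) ++ applyUpTo (λ i → g′ (s ∸ k + i)) k
    ≡⟨ applyUpTo-+ g′ (s ∸ k) k ⟨
  applyUpTo g′ (s ∸ k + k)
    ≡⟨ cong (applyUpTo g′) (m∸n+n≡m k≤s) ⟩
  applyUpTo g′ s ∎
  where
  open ≡-Reasoning
  g′ = λ i → g (k + i)
  wrap : ∀ i → g i ≡ g′ (s ∸ k + i)
  wrap i = sym (trans (cong g (trans (sym (+-assoc k (s ∸ k) i)) (trans (cong (_+ i) (m+[n∸m]≡n k≤s)) (+-comm s i)))) (per i))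

nthCyc-applyUpTo : ∀ {g : ℕ → ℕ} {s₀} → Period (suc s₀) g → ∀ i → nthCyc (applyUpTo g (suc s₀)) i ≡ g i
nthCyc-applyUpTo {g} {s₀} per i = begin
  nth (applyUpTo g s) (i % suc (length (applyUpTo (g ∘ suc) s₀)))
    ≡⟨ cong (λ m → nth (applyUpTo g s) (i % suc m)) (length-applyUpTo (g ∘ suc) s₀) ⟩
  nth (applyUpTo g s) (i % s)  ≡⟨ nth-applyUpTo g (m%n<n i s) ⟩
  g (i % s)                    ≡⟨ period-% per i ⟨
  g i                          ∎
  where
  open ≡-Reasoning
  s = suc s₀

-- Permutations of a list

insertions : A → List A → List (List A)
insertions x [] = (x ∷ []) ∷ []
insertions x (y ∷ ys) = (x ∷ y ∷ ys) ∷ map (y ∷_) (insertions x ys)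

permutations : List A → List (List A)
permutations [] = [] ∷ []
permutations (x ∷ xs) = concatMap (insertions x) (permutations xs)

∈-insertions⁻ : ∀ {x : A} ys {q} → q ∈ insertions x ys → q ↭ x ∷ ys
∈-insertions⁻ [] (here refl) = ↭-refl
∈-insertions⁻ (y ∷ ys) (here refl) = ↭-refl
∈-insertions⁻ {x = x} (y ∷ ys) (there q∈) with ∈-map⁻ (y ∷_) q∈
... | _ , q′∈ , refl = ↭-trans (prep y (∈-insertions⁻ ys q′∈)) (swap y x ↭-refl)

∈-insertions⁺ : ∀ (x : A) ys zs → ys ++ x ∷ zs ∈ insertions x (ys ++ zs)
∈-insertions⁺ x [] [] = here refl
∈-insertions⁺ x [] (z ∷ zs) = here refl
∈-insertions⁺ x (y ∷ ys) zs = there (∈-map⁺ (y ∷_) (∈-insertions⁺ x ys zs))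

insertions-injective : ∀ {x : A} {ys ys′ q} → x ∉ ys → x ∉ ys′ →
                       q ∈ insertions x ys → q ∈ insertions x ys′ → ys ≡ ys′
insertions-injective {ys = []} {[]} _ _ _ _ = refl
insertions-injective {ys = []} {_ ∷ _} _ _ (here refl) (here ())
insertions-injective {ys = _ ∷ _} {[]} _ _ (here ()) (here refl)
insertions-injective {ys = _ ∷ _} {_ ∷ _} _ _ (here refl) (here refl) = refl
insertions-injective {ys = []} {y′ ∷ _} _ x∉ys′ (here refl) (there q∈) with ∈-map⁻ (y′ ∷_) q∈
... | _ , _ , e = ⊥-elim (x∉ys′ (here (∷-injectiveˡ e)))
insertions-injective {ys = _ ∷ _} {y′ ∷ _} _ x∉ys′ (here refl) (there q∈) with ∈-map⁻ (y′ ∷_) q∈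
... | _ , _ , e = ⊥-elim (x∉ys′ (here (∷-injectiveˡ e)))
insertions-injective {ys = y ∷ _} {[]} x∉ys _ (there q∈) (here refl) with ∈-map⁻ (y ∷_) q∈
... | _ , _ , e = ⊥-elim (x∉ys (here (∷-injectiveˡ e)))
insertions-injective {ys = y ∷ _} {_ ∷ _} x∉ys _ (there q∈) (here refl) with ∈-map⁻ (y ∷_) q∈
... | _ , _ , e = ⊥-elim (x∉ys (here (∷-injectiveˡ e)))
insertions-injective {ys = y ∷ ys} {y′ ∷ ys′} x∉ys x∉ys′ (there q∈) (there q∈′)
  with ∈-map⁻ (y ∷_) q∈ | ∈-map⁻ (y′ ∷_) q∈′
... | _ , r∈ , refl | _ , r∈′ , refl =
  cong (y ∷_) (insertions-injective (x∉ys ∘ there) (x∉ys′ ∘ there) r∈ r∈′)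

insertions-unique : ∀ {x : A} ys → x ∉ ys → Unique (insertions x ys)
insertions-unique [] _ = [] ∷ []
insertions-unique {x = x} (y ∷ ys) x∉ =
  All.map⁺ (All.tabulate head-differs) ∷ Unique.map⁺ ∷-injectiveʳ (insertions-unique ys (x∉ ∘ there))
  where
  head-differs : ∀ {q} → q ∈ insertions x ys → x ∷ y ∷ ys ≢ y ∷ q
  head-differs _ refl = x∉ (here refl)

∈-permutations⁻ : ∀ (xs : List A) {q} → q ∈ permutations xs → q ↭ xs
∈-permutations⁻ [] (here refl) = ↭-refl
∈-permutations⁻ (x ∷ xs) q∈ with find (∈-concatMap⁻ (insertions x) {xs = permutations xs} q∈)
... | r , r∈ , q∈′ = ↭-trans (∈-insertions⁻ r q∈′) (prep x (∈-permutations⁻ xs r∈))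

∈-permutations⁺ : ∀ (xs : List A) {q} → q ↭ xs → q ∈ permutations xs
∈-permutations⁺ [] p rewrite ↭-empty-inv p = here refl
∈-permutations⁺ (x ∷ xs) p with ∈-∃++ (∈-resp-↭ (↭-sym p) (here refl))
... | ys , zs , refl = ∈-concatMap⁺ (insertions x) {xs = permutations xs}
  (lose (∈-permutations⁺ xs (drop-mid ys [] p)) (∈-insertions⁺ x ys zs))

permutations-unique : ∀ {xs : List A} → Unique xs → Unique (permutations xs)
permutations-unique {xs = []} _ = [] ∷ []
permutations-unique {xs = x ∷ xs} (x∉ ∷ u) =
  Unique.concat⁺ (All.map⁺ (All.tabulate (λ r∈ → insertions-unique _ (x∉r r∈))))
    (AllPairs.map⁺ (AllPairs-strengthen disjoint (All.tabulate (λ r∈ → x∉r r∈)) (permutations-unique u)))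
  where
  x∉r : ∀ {r} → r ∈ permutations xs → x ∉ r
  x∉r r∈ x∈ = All.lookup x∉ (∈-resp-↭ (∈-permutations⁻ xs r∈) x∈) refl
  disjoint : ∀ {r r′} → x ∉ r → x ∉ r′ → r ≢ r′ → ∀ {q} → ¬ (q ∈ insertions x r × q ∈ insertions x r′)
  disjoint x∉r x∉r′ r≢r′ (q∈ , q∈′) = r≢r′ (insertions-injective x∉r x∉r′ q∈ q∈′)

length-permutations : ∀ (xs : List A) → length (permutations xs) ≡ length xs !
length-permutations [] = refl
length-permutations (x ∷ xs) = begin
  length (concatMap (insertions x) (permutations xs))
    ≡⟨ length-concatMap-insertions (permutations xs) (All.tabulate (↭-length ∘ ∈-permutations⁻ xs)) ⟩
  length (permutations xs) * suc (length xs)          ≡⟨ cong (_* suc (length xs)) (length-permutations xs) ⟩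
  length xs ! * suc (length xs)                       ≡⟨ *-comm (length xs !) (suc (length xs)) ⟩
  suc (length xs) !                                   ∎
  where
  open ≡-Reasoning
  length-insertions : ∀ r → length (insertions x r) ≡ suc (length r)
  length-insertions [] = refl
  length-insertions (y ∷ ys) = cong suc (trans (length-map (y ∷_) (insertions x ys)) (length-insertions ys))
  length-concatMap-insertions : ∀ rs → All (λ r → length r ≡ length xs) rs →
                                length (concatMap (insertions x) rs) ≡ length rs * suc (length xs)
  length-concatMap-insertions [] [] = refl
  length-concatMap-insertions (r ∷ rs) (e ∷ es) =
    trans (length-++ (insertions x r)) (cong₂ _+_ (trans (length-insertions r) (cong suc e)) (length-concatMap-insertions rs es))

module Refill {Q : A → Set} (Q? : Decidable Q) where

  fixed : List A → List A
  fixed = filter Q?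

  free : List A → List A
  free = filter (¬? ∘ Q?)

  Agree : A × A → Set
  Agree (a , b) = (Q a → a ≡ b) × (Q b → a ≡ b)

  -- If q is too short, the remaining entries of π outside Q are kept.
  refill : List A → List A → List A
  refill [] q = []
  refill (x ∷ π) q with Q? x
  ... | yes _ = x ∷ refill π q
  refill (x ∷ π) [] | no _ = x ∷ refill π []
  refill (x ∷ π) (y ∷ q) | no _ = y ∷ refill π q

  free-¬ : ∀ π → All (¬_ ∘ Q) (free π)
  free-¬ = All.all-filter (¬? ∘ Q?)

  fixed++free-↭ : ∀ π → fixed π ++ free π ↭ π
  fixed++free-↭ [] = ↭-refl
  fixed++free-↭ (x ∷ π) with Q? x
  ... | yes _ = prep x (fixed++free-↭ π)
  ... | no _ = ↭-trans (shift x (fixed π) (free π)) (prep x (fixed++free-↭ π))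

  length-fixed+free : ∀ π → length (fixed π) + length (free π) ≡ length π
  length-fixed+free π = trans (sym (length-++ (fixed π))) (↭-length (fixed++free-↭ π))

  refill-↭ : ∀ π q → length q ≡ length (free π) → refill π q ↭ fixed π ++ q
  refill-↭ [] [] _ = ↭-refl
  refill-↭ (x ∷ π) q e with Q? x
  ... | yes _ = prep x (refill-↭ π q e)
  refill-↭ (x ∷ π) (y ∷ q) e | no _ =
    ↭-trans (prep y (refill-↭ π q (suc-injective e))) (↭-sym (shift y (fixed π) q))

  refill-agrees : ∀ π q → length q ≡ length (free π) → All (¬_ ∘ Q) q → All Agree (zip π (refill π q))
  refill-agrees [] q _ _ = []
  refill-agrees (x ∷ π) q e ¬Qq with Q? x
  ... | yes _ = ((λ _ → refl) , (λ _ → refl)) ∷ refill-agrees π q e ¬Qq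
  refill-agrees (x ∷ π) (y ∷ q) e (¬Qy ∷ ¬Qq) | no ¬Qx =
    (⊥-elim ∘ ¬Qx , ⊥-elim ∘ ¬Qy) ∷ refill-agrees π q (suc-injective e) ¬Qq

  free-refill : ∀ π q → length q ≡ length (free π) → All (¬_ ∘ Q) q → free (refill π q) ≡ q
  free-refill [] [] _ _ = refl
  free-refill (x ∷ π) q e ¬Qq with Q? x in Qx
  ... | yes _ rewrite Qx = free-refill π q e ¬Qq
  free-refill (x ∷ π) (y ∷ q) e (¬Qy ∷ ¬Qq) | no _ with Q? y
  ... | yes Qy = ⊥-elim (¬Qy Qy)
  ... | no _ = cong (y ∷_) (free-refill π q (suc-injective e) ¬Qq)

  agree⇒refill-free : ∀ π σ → length σ ≡ length π → All Agree (zip π σ) → σ ≡ refill π (free σ)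
  agree⇒refill-free [] [] _ _ = refl
  agree⇒refill-free (x ∷ π) (y ∷ σ) e ((x≡ , ≡y) ∷ agree) with Q? x
  ... | yes Qx with x≡ Qx
  ...   | refl with Q? x
  ...     | yes _ = cong (x ∷_) (agree⇒refill-free π σ (suc-injective e) agree)
  ...     | no ¬Qx = ⊥-elim (¬Qx Qx)
  agree⇒refill-free (x ∷ π) (y ∷ σ) e ((x≡ , ≡y) ∷ agree) | no ¬Qx with Q? y
  ... | yes Qy = ⊥-elim (¬Qx (subst Q (sym (≡y Qy)) Qy))
  ... | no _ = cong (y ∷_) (agree⇒refill-free π σ (suc-injective e) agree)

-- Orbits of a free cyclic action

module FreeOrbits (_≟_ : DecidableEquality A) (φ : A → A) (p₀ : ℕ) (Xs : List A)
  (closed : ∀ {x} → x ∈ Xs → φ x ∈ Xs)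
  (cyclic : ∀ {x} → x ∈ Xs → fold x φ (suc p₀) ≡ x)
  (minimal : ∀ {x} → x ∈ Xs → ∀ j → 1 ≤ j → j < suc p₀ → fold x φ j ≢ x)
  where

  open DecMembership _≟_ using (_∈?_)

  p : ℕ
  p = suc p₀

  orbit : A → List A
  orbit x = applyUpTo (fold x φ) p

  Closed : List A → Set
  Closed Ys = ∀ {z} → z ∈ Ys → φ z ∈ Ys

  fold-∈ : ∀ {Ys x} → Closed Ys → x ∈ Ys → ∀ j → fold x φ j ∈ Ys
  fold-∈ cl x∈ zero = x∈
  fold-∈ cl x∈ (suc j) = cl (fold-∈ cl x∈ j)

  fold-period : ∀ {x} → x ∈ Xs → Period p (fold x φ)
  fold-period x∈ i = trans (fold-+ _ φ i) (cong (λ y → fold y φ i) (cyclic x∈))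

  ∈-orbit⁺ : ∀ {x} → x ∈ Xs → ∀ j → fold x φ j ∈ orbit x
  ∈-orbit⁺ {x} x∈ j = subst (_∈ orbit x) (sym (period-% (fold-period x∈) j)) (applyUpTo⁺ (fold x φ) refl (m%n<n j p))

  ∈-orbit⁻ : ∀ {x z} → z ∈ orbit x → ∃ λ j → fold x φ j ≡ z
  ∈-orbit⁻ {x} z∈ with applyUpTo⁻ (fold x φ) z∈
  ... | j , _ , e = j , sym e

  orbit-unique : ∀ {x} → x ∈ Xs → Unique (orbit x)
  orbit-unique {x} x∈ = Unique.applyUpTo⁺₁ (fold x φ) p distinct
    where
    distinct : ∀ {i j} → i < j → j < p → fold x φ i ≢ fold x φ j
    distinct {i} {j} i<j j<p e = minimal (fold-∈ closed x∈ i) (j ∸ i) (m<n⇒0<n∸m i<j) (≤-<-trans (m∸n≤m j i) j<p) (begin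
      fold (fold x φ i) φ (j ∸ i) ≡⟨ fold-+ x φ (j ∸ i) ⟨
      fold x φ (j ∸ i + i)        ≡⟨ cong (fold x φ) (m∸n+n≡m (<⇒≤ i<j)) ⟩
      fold x φ j                  ≡⟨ e ⟨
      fold x φ i                  ∎)
      where open ≡-Reasoning

  orbit-backward-closed : ∀ {y z} → y ∈ Xs → z ∈ Xs → φ z ∈ orbit y → z ∈ orbit y
  orbit-backward-closed {y} {z} y∈ z∈ φz∈ with ∈-orbit⁻ φz∈
  ... | i , e = subst (_∈ orbit y) z≡ (∈-orbit⁺ y∈ (p₀ + i))
    where
    z≡ : fold y φ (p₀ + i) ≡ z
    z≡ = begin
      fold y φ (p₀ + i)         ≡⟨ fold-+ y φ p₀ ⟩
      fold (fold y φ i) φ p₀    ≡⟨ cong (λ w → fold w φ p₀) e ⟩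
      fold (φ z) φ p₀           ≡⟨ fold-+ z φ p₀ ⟨
      fold z φ (p₀ + 1)         ≡⟨ cong (fold z φ) (+-comm p₀ 1) ⟩
      fold z φ p                ≡⟨ cyclic z∈ ⟩
      z                         ∎
      where open ≡-Reasoning

  orbit⊆ : ∀ {y Ys} → Closed Ys → y ∈ Ys → ∀ {z} → z ∈ orbit y → z ∈ Ys
  orbit⊆ cl y∈ z∈ with ∈-orbit⁻ z∈
  ... | j , refl = fold-∈ cl y∈ j

  module Split (y : A) where
    open Refill (_∈? orbit y) public using (fixed; free; length-fixed+free)

    length-split : ∀ {Ys} → Unique Ys → All (_∈ Xs) Ys → Closed Ys → y ∈ Ys → length Ys ≡ p + length (free Ys)
    length-split {Ys} u ⊆X cl y∈ = begin
      length Ys                             ≡⟨ length-fixed+free Ys ⟨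
      length (fixed Ys) + length (free Ys)
        ≡⟨ cong (_+ length (free Ys)) (trans (↭-length fixed↭orbit) (length-applyUpTo (fold y φ) p)) ⟩
      p + length (free Ys)                  ∎
      where
      open ≡-Reasoning
      fixed↭orbit : fixed Ys ↭ orbit y
      fixed↭orbit = unique-set-↭ (Unique.filter⁺ (_∈? orbit y) u) (orbit-unique (All.lookup ⊆X y∈))
        (proj₂ ∘ ∈-filter⁻ (_∈? orbit y) {xs = Ys}) (λ z∈ → ∈-filter⁺ (_∈? orbit y) (orbit⊆ cl y∈ z∈) z∈)

    free-closed : ∀ {Ys} → All (_∈ Xs) Ys → Closed Ys → y ∈ Xs → Closed (free Ys)
    free-closed ⊆X cl y∈ z∈ with ∈-filter⁻ (¬? ∘ (_∈? orbit y)) z∈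
    ... | z∈Ys , z∉ = ∈-filter⁺ (¬? ∘ (_∈? orbit y)) (cl z∈Ys) (z∉ ∘ orbit-backward-closed y∈ (All.lookup ⊆X z∈Ys))

  record Transversal (Ys R : List A) : Set where
    field
      ⊆Ys    : All (_∈ Ys) R
      apart  : AllPairs (λ a b → ¬ (∃ λ j → fold a φ j ≡ b)) R
      covers : ∀ {z} → z ∈ Ys → Any (λ r → ∃ λ j → fold r φ j ≡ z) R
      count  : length R * p ≡ length Ys

  transversal : ∀ fuel Ys → length Ys ≤ fuel → Unique Ys → All (_∈ Xs) Ys → Closed Ys → ∃ (Transversal Ys)
  transversal _ [] _ _ _ _ = [] , record { ⊆Ys = [] ; apart = [] ; covers = λ () ; count = refl }
  transversal (suc fuel) Ys@(y ∷ _) len u ⊆X cl = y ∷ R , record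
    { ⊆Ys    = here refl ∷ All.map (proj₁ ∘ ∈-filter⁻ outside?) (⊆Ys T)
    ; apart  = All.map (λ r∈ (j , e) → proj₂ (∈-filter⁻ outside? r∈) (subst (_∈ orbit y) e (∈-orbit⁺ y∈Xs j))) (⊆Ys T)
               ∷ apart T
    ; covers = covers′
    ; count  = trans (cong (p +_) (count T)) (sym split)
    }
    where
    open Split y
    open Transversal
    outside? = ¬? ∘ (_∈? orbit y)
    y∈Xs = All.lookup ⊆X (here refl)
    split = length-split u ⊆X cl (here refl)
    rest = transversal fuel (free Ys)
      (≤-pred (≤-trans (subst (suc (length (free Ys)) ≤_) (sym split) (s≤s (m≤n+m _ p₀))) len))
      (Unique.filter⁺ outside? u) (All.filter⁺ outside? ⊆X) (free-closed ⊆X cl y∈Xs)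
    R = proj₁ rest
    T = proj₂ rest
    covers′ : ∀ {z} → z ∈ Ys → Any (λ r → ∃ λ j → fold r φ j ≡ z) (y ∷ R)
    covers′ {z} z∈ with z ∈? orbit y
    ... | yes z∈orbit = here (∈-orbit⁻ z∈orbit)
    ... | no z∉orbit = there (covers T (∈-filter⁺ outside? z∈ z∉orbit))

  orbitTransversal : Unique Xs → ∃ (Transversal Xs)
  orbitTransversal u = transversal (length Xs) Xs ≤-refl u (All.tabulate (λ x∈ → x∈)) closed

-- Iterating topdrop

iter-+ : ∀ a b π → iter (a + b) π ≡ iter a (iter b π)
iter-+ zero b π = refl
iter-+ (suc a) b π = cong topdrop (iter-+ a b π)

iter-comm : ∀ a b π → iter a (iter b π) ≡ iter b (iter a π)
iter-comm a b π = trans (sym (iter-+ a b π)) (trans (cong (λ k → iter k π) (+-comm a b)) (iter-+ b a π))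

iter-period : ∀ {s π} → iter s π ≡ π → Period s (λ k → iter k π)
iter-period {s} {π} fixed i = trans (iter-+ i s π) (cong (iter i) fixed)

iter-undo : ∀ {s₀ π} → iter (suc s₀) π ≡ π → ∀ k → iter (k * s₀) (iter k π) ≡ π
iter-undo {s₀} {π} fixed k = begin
  iter (k * s₀) (iter k π) ≡⟨ iter-+ (k * s₀) k π ⟨
  iter (k * s₀ + k) π      ≡⟨ cong (λ m → iter m π) (trans (+-comm (k * s₀) k) (sym (*-suc k s₀))) ⟩
  iter (k * suc s₀) π      ≡⟨ period-* (iter-period fixed) k 0 ⟩
  π                        ∎
  where open ≡-Reasoning

OrbitSize-iter : ∀ {π s} → OrbitSize π s → ∀ k → OrbitSize (iter k π) s
OrbitSize-iter {π} {suc s₀} (1≤s , fixed , minimal) k = 1≤s , fixed′ , minimal′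
  where
  fixed′ : iter (suc s₀) (iter k π) ≡ iter k π
  fixed′ = trans (iter-comm (suc s₀) k π) (cong (iter k) fixed)
  minimal′ : ∀ j → 1 ≤ j → j < suc s₀ → iter j (iter k π) ≢ iter k π
  minimal′ j 1≤j j<s e = minimal j 1≤j j<s (begin
    iter j π                              ≡⟨ cong (iter j) (iter-undo fixed k) ⟨
    iter j (iter (k * s₀) (iter k π))     ≡⟨ iter-comm j (k * s₀) (iter k π) ⟩
    iter (k * s₀) (iter j (iter k π))     ≡⟨ cong (iter (k * s₀)) e ⟩
    iter (k * s₀) (iter k π)              ≡⟨ iter-undo fixed k ⟩
    π                                     ∎)
    where open ≡-Reasoning

fold-iter : ∀ t σ j → fold σ (iter t) j ≡ iter (j * t) σ
fold-iter t σ zero = refl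
fold-iter t σ (suc j) = trans (cong (iter t) (fold-iter t σ j)) (sym (iter-+ t (j * t) σ))

topdrop-↭ : ∀ π → topdrop π ↭ π
topdrop-↭ [] = ↭-refl
topdrop-↭ (x ∷ xs) = drop++reverse-take-↭ x (x ∷ xs)

iter-↭ : ∀ k π → iter k π ↭ π
iter-↭ zero π = ↭-refl
iter-↭ (suc k) π = ↭-trans (topdrop-↭ (iter k π)) (iter-↭ k π)

InS-unique : ∀ {n σ} → InS n σ → Unique σ
InS-unique {n} σ↭ = Unique-resp-↭ˡ σ↭ (Unique.map⁺ suc-injective (Unique.upTo⁺ n))

InS-length : ∀ {n σ} → InS n σ → length σ ≡ n
InS-length {n} σ↭ = trans (↭-length σ↭) (trans (length-map suc (upTo n)) (length-upTo n))

rotate-↭ : ∀ k (xs : List ℕ) → rotate k xs ↭ xs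
rotate-↭ k xs = ↭-trans (++-comm (drop k xs) (take k xs)) (↭-reflexive (take++drop≡id k xs))

rotate-all : ∀ k (xs : List ℕ) → length xs ≤ k → rotate k xs ≡ xs
rotate-all k xs le = cong₂ _++_ (drop-all k xs le) (take-all k xs le)

firstEntry : List ℕ → ℕ → ℕ
firstEntry π k = first (iter k π)

firstEntries-applyUpTo : ∀ π s → firstEntries π s ≡ applyUpTo (firstEntry π) s
firstEntries-applyUpTo π = map-upTo (firstEntry π)

length-firstEntries : ∀ π s → length (firstEntries π s) ≡ s
length-firstEntries π s = trans (length-map (firstEntry π) (upTo s)) (length-upTo s)

firstEntry-iter : ∀ π k i → firstEntry (iter k π) i ≡ firstEntry π (i + k)
firstEntry-iter π k i = cong first (sym (iter-+ i k π))

firstEntry-period : ∀ {s π} → iter s π ≡ π → Period s (firstEntry π)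
firstEntry-period fixed i = cong first (iter-period fixed i)

firstEntries-iter : ∀ {s π k} → iter s π ≡ π → k ≤ s → firstEntries (iter k π) s ≡ rotate k (firstEntries π s)
firstEntries-iter {s} {π} {k} fixed k≤s = begin
  firstEntries (iter k π) s                   ≡⟨ firstEntries-applyUpTo (iter k π) s ⟩
  applyUpTo (firstEntry (iter k π)) s
    ≡⟨ applyUpTo-cong (λ i → trans (firstEntry-iter π k i) (cong (firstEntry π) (+-comm i k))) s ⟩
  applyUpTo (λ i → firstEntry π (k + i)) s    ≡⟨ rotate-applyUpTo (firstEntry-period fixed) k≤s ⟨
  rotate k (applyUpTo (firstEntry π) s)       ≡⟨ cong (rotate k) (firstEntries-applyUpTo π s) ⟨
  rotate k (firstEntries π s)                 ∎
  where open ≡-Reasoning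

rotation-realised : ∀ {π s N} k → OrbitSize π s → N ≡ rotate k (firstEntries π s) →
                    ∃ λ k′ → firstEntries (iter k′ π) s ≡ N
rotation-realised {π} {s} k (_ , fixed , _) N≡ with k ≤? s
... | yes k≤s = k , trans (firstEntries-iter fixed k≤s) (sym N≡)
... | no k≰s = 0 , sym (trans N≡ (rotate-all k (firstEntries π s) (subst (_≤ k) (sym (length-firstEntries π s)) (≰⇒≥ k≰s))))

-- Running topdrop on two permutations at once

topdropOn : (A → ℕ) → List A → List A
topdropOn key [] = []
topdropOn key (x ∷ xs) = drop (key x) (x ∷ xs) ++ reverse (take (key x) (x ∷ xs))

topdropOn-↭ : ∀ (key : A → ℕ) xs → topdropOn key xs ↭ xs
topdropOn-↭ key [] = ↭-refl
topdropOn-↭ key (x ∷ xs) = drop++reverse-take-↭ (key x) (x ∷ xs)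

map-topdropOn : ∀ (key : A → ℕ) (g : A → ℕ) x xs → g x ≡ key x →
                map g (topdropOn key (x ∷ xs)) ≡ topdrop (map g (x ∷ xs))
map-topdropOn key g x xs gx≡ = begin
  map g (drop k (x ∷ xs) ++ reverse (take k (x ∷ xs)))      ≡⟨ map-++ g (drop k (x ∷ xs)) _ ⟩
  map g (drop k (x ∷ xs)) ++ map g (reverse (take k (x ∷ xs)))
    ≡⟨ cong₂ _++_ (sym (drop-map k (x ∷ xs)))
                  (trans (reverse-map g (take k (x ∷ xs))) (cong reverse (sym (take-map k (x ∷ xs))))) ⟩
  drop k (map g (x ∷ xs)) ++ reverse (take k (map g (x ∷ xs)))
    ≡⟨ cong (λ m → drop m (map g (x ∷ xs)) ++ reverse (take m (map g (x ∷ xs)))) gx≡ ⟨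
  topdrop (map g (x ∷ xs))                                    ∎
  where
  open ≡-Reasoning
  k = key x

-- jointIter k (zip π σ) performs k topdrops on π and carries the entries of σ along
-- with those of π.
jointIter : ℕ → List (ℕ × ℕ) → List (ℕ × ℕ)
jointIter k Z = fold Z (topdropOn proj₁) k

jointIter-↭ : ∀ k Z → jointIter k Z ↭ Z
jointIter-↭ zero Z = ↭-refl
jointIter-↭ (suc k) Z = ↭-trans (topdropOn-↭ proj₁ (jointIter k Z)) (jointIter-↭ k Z)

map-proj₁-jointIter : ∀ k Z → map proj₁ (jointIter k Z) ≡ iter k (map proj₁ Z)
map-proj₁-jointIter zero Z = refl
map-proj₁-jointIter (suc k) Z = trans (step (jointIter k Z)) (cong topdrop (map-proj₁-jointIter k Z))
  where
  step : ∀ W → map proj₁ (topdropOn proj₁ W) ≡ topdrop (map proj₁ W)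
  step [] = refl
  step (w ∷ W) = map-topdropOn proj₁ proj₁ w W refl

HeadDiagonal : List (ℕ × ℕ) → Set
HeadDiagonal W = first (map proj₁ W) ≡ first (map proj₂ W)

Coupled : List (ℕ × ℕ) → Set
Coupled Z = ∀ k → map proj₂ (jointIter k Z) ≡ iter k (map proj₂ Z)

coupled : ∀ Z → (∀ k → map proj₂ (jointIter k Z) ≡ iter k (map proj₂ Z) → HeadDiagonal (jointIter k Z)) → Coupled Z
coupled Z diagonal zero = refl
coupled Z diagonal (suc k) = trans (step (jointIter k Z) (diagonal k ih)) (cong topdrop ih)
  where
  ih = coupled Z diagonal k
  step : ∀ W → HeadDiagonal W → map proj₂ (topdropOn proj₁ W) ≡ topdrop (map proj₂ W)
  step [] _ = refl
  step (w ∷ W) e = map-topdropOn proj₁ proj₂ w W (sym e)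

jointIter-fixed : ∀ (f : ℕ × ℕ → ℕ) k Z → Unique (map f Z) → map f (jointIter k Z) ≡ map f Z → jointIter k Z ≡ Z
jointIter-fixed f k Z u e = ↭∧map≡⇒≡ f (jointIter-↭ k Z) u e

coupled-OrbitSize : ∀ {Z s} → Unique (map proj₁ Z) → Unique (map proj₂ Z) → Coupled Z →
                    OrbitSize (map proj₁ Z) s → OrbitSize (map proj₂ Z) s
coupled-OrbitSize {Z} {s} u₁ u₂ cpl (1≤s , fixed , minimal) = 1≤s , fixed′ , minimal′
  where
  fixed′ : iter s (map proj₂ Z) ≡ map proj₂ Z
  fixed′ = trans (sym (cpl s)) (cong (map proj₂)
    (jointIter-fixed proj₁ s Z u₁ (trans (map-proj₁-jointIter s Z) fixed)))
  minimal′ : ∀ j → 1 ≤ j → j < s → iter j (map proj₂ Z) ≢ map proj₂ Z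
  minimal′ j 1≤j j<s e = minimal j 1≤j j<s (trans (sym (map-proj₁-jointIter j Z))
    (cong (map proj₁) (jointIter-fixed proj₂ j Z u₂ (trans (cpl j) e))))

headDiagonal : ∀ {W} → (∀ {h} → h ∈ W → first (map proj₁ W) ≡ proj₁ h → proj₁ h ≡ proj₂ h) → HeadDiagonal W
headDiagonal {[]} _ = refl
headDiagonal {h ∷ W} diagonal = diagonal (here refl) refl

-- Permutations aligned with a given one

module AlignedWith {n s₀ : ℕ} {π : List ℕ} (π∈Sₙ : InS n π) (π-orbit : OrbitSize π (suc s₀)) where

  open DecMembership _≟_ using (_∈?_)

  s : ℕ
  s = suc s₀

  N : List ℕ
  N = firstEntries π s

  entry : ℕ → ℕ
  entry = firstEntry π

  Aligned : List ℕ → Set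
  Aligned σ = InS n σ × OrbitSize σ s × firstEntries σ s ≡ N

  entry-period : Period s entry
  entry-period = firstEntry-period (proj₁ (proj₂ π-orbit))

  ∈N⁺ : ∀ k → entry k ∈ N
  ∈N⁺ k = subst (_∈ N) (sym (period-% entry-period k))
    (subst (entry (k % s) ∈_) (sym (firstEntries-applyUpTo π s)) (applyUpTo⁺ entry refl (m%n<n k s)))

  ∈N⁻ : ∀ {a} → a ∈ N → ∃ λ k → a ≡ entry k
  ∈N⁻ {a} a∈ with applyUpTo⁻ entry (subst (a ∈_) (firstEntries-applyUpTo π s) a∈)
  ... | k , _ , a≡ = k , a≡

  aligned-entry : ∀ {σ} → Aligned σ → ∀ k → firstEntry σ k ≡ entry k
  aligned-entry {σ} (_ , (_ , fixed , _) , σ≡) = period-≗ (firstEntry-period fixed) entry-period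
    (applyUpTo-injective s (trans (sym (firstEntries-applyUpTo σ s)) (trans σ≡ (firstEntries-applyUpTo π s))))

  open Refill (_∈? N)

  Compatible : List ℕ → Set
  Compatible σ = All Agree (zip π σ)

  module Zipped {σ : List ℕ} (σ∈Sₙ : InS n σ) where

    Z : List (ℕ × ℕ)
    Z = zip π σ

    lengths : length π ≡ length σ
    lengths = trans (InS-length π∈Sₙ) (sym (InS-length σ∈Sₙ))

    π-track : ∀ k → map proj₁ (jointIter k Z) ≡ iter k π
    π-track k = trans (map-proj₁-jointIter k Z) (cong (iter k) (map-proj₁-zip lengths))

    unique₁ : Unique (map proj₁ Z)
    unique₁ = subst Unique (sym (map-proj₁-zip lengths)) (InS-unique π∈Sₙ)

    unique₂ : Unique (map proj₂ Z)
    unique₂ = subst Unique (sym (map-proj₂-zip lengths)) (InS-unique σ∈Sₙ)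

    σ-track : Coupled Z → ∀ k → map proj₂ (jointIter k Z) ≡ iter k σ
    σ-track cpl k = trans (cpl k) (cong (iter k) (map-proj₂-zip lengths))

  compatible⇒aligned : ∀ {σ} → InS n σ → Compatible σ → Aligned σ
  compatible⇒aligned {σ} σ∈Sₙ agree =
    σ∈Sₙ , subst (λ l → OrbitSize l s) (map-proj₂-zip lengths) orbit , entries
    where
    open Zipped σ∈Sₙ
    heads : ∀ k → HeadDiagonal (jointIter k Z)
    heads k = headDiagonal λ h∈ e → proj₁ (All.lookup agree (∈-resp-↭ (jointIter-↭ k Z) h∈))
      (subst (_∈ N) (trans (cong first (sym (π-track k))) e) (∈N⁺ k))
    cpl : Coupled Z
    cpl = coupled Z λ k _ → heads k
    orbit : OrbitSize (map proj₂ Z) s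
    orbit = coupled-OrbitSize unique₁ unique₂ cpl (subst (λ l → OrbitSize l s) (sym (map-proj₁-zip lengths)) π-orbit)
    entries : firstEntries σ s ≡ N
    entries = begin
      firstEntries σ s            ≡⟨ firstEntries-applyUpTo σ s ⟩
      applyUpTo (firstEntry σ) s  ≡⟨ applyUpTo-cong same-entry s ⟩
      applyUpTo entry s           ≡⟨ firstEntries-applyUpTo π s ⟨
      N                           ∎
      where
      open ≡-Reasoning
      same-entry : ∀ k → firstEntry σ k ≡ entry k
      same-entry k = trans (cong first (sym (σ-track cpl k))) (trans (sym (heads k)) (cong first (π-track k)))

  aligned⇒compatible : ∀ {σ} → Aligned σ → Compatible σ
  aligned⇒compatible {σ} aligned@(σ∈Sₙ , _ , _) = All.tabulate agree
    where
    open Zipped σ∈Sₙ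
    cpl : Coupled Z
    cpl = coupled Z λ k σ-k → begin
      first (map proj₁ (jointIter k Z))  ≡⟨ cong first (π-track k) ⟩
      entry k                            ≡⟨ aligned-entry aligned k ⟨
      first (iter k σ)                   ≡⟨ cong (first ∘ iter k) (map-proj₂-zip lengths) ⟨
      first (iter k (map proj₂ Z))       ≡⟨ cong first σ-k ⟨
      first (map proj₂ (jointIter k Z))  ∎
      where open ≡-Reasoning
    diagonal-∈ : ∀ {w} → w ∈ Z → ∀ k → (entry k , entry k) ∈ Z
    diagonal-∈ w∈ k with head-∈ (∈-resp-↭ (↭-sym (jointIter-↭ k Z)) w∈)
    ... | h , h∈ , heads = subst (_∈ Z) h≡ (∈-resp-↭ (jointIter-↭ k Z) h∈)
      where
      h≡ : h ≡ (entry k , entry k)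
      h≡ = cong₂ _,_ (trans (sym (heads proj₁)) (cong first (π-track k)))
                     (trans (sym (heads proj₂)) (trans (cong first (σ-track cpl k)) (aligned-entry aligned k)))
    agree : ∀ {w} → w ∈ Z → Agree w
    agree {a , b} w∈ = diagonal proj₁ (λ _ → refl) unique₁ , diagonal proj₂ (λ _ → refl) unique₂
      where
      diagonal : (f : ℕ × ℕ → ℕ) → (∀ x → x ≡ f (x , x)) → Unique (map f Z) → f (a , b) ∈ N → a ≡ b
      diagonal f f-diag u fw∈N with ∈N⁻ fw∈N
      ... | k , fw≡ with map-injectiveOn f u w∈ (diagonal-∈ w∈ k) (trans fw≡ (f-diag (entry k)))
      ...   | refl = refl

  alignedPerms : List (List ℕ)
  alignedPerms = map (refill π) (permutations (free π))

  refill-aligned : ∀ {q} → q ↭ free π → Aligned (refill π q)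
  refill-aligned {q} q↭ =
    compatible⇒aligned refill∈Sₙ (refill-agrees π q (↭-length q↭) (All-resp-↭ (↭-sym q↭) (free-¬ π)))
    where
    refill∈Sₙ : InS n (refill π q)
    refill∈Sₙ = ↭-trans (refill-↭ π q (↭-length q↭))
                  (↭-trans (++⁺ˡ (fixed π) q↭) (↭-trans (fixed++free-↭ π) π∈Sₙ))

  ∈-alignedPerms⁻ : ∀ {σ} → σ ∈ alignedPerms → Aligned σ
  ∈-alignedPerms⁻ σ∈ with ∈-map⁻ (refill π) σ∈
  ... | q , q∈ , refl = refill-aligned (∈-permutations⁻ (free π) q∈)

  ∈-alignedPerms⁺ : ∀ {σ} → Aligned σ → σ ∈ alignedPerms
  ∈-alignedPerms⁺ {σ} aligned@(σ∈Sₙ , _ , _) =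
    subst (_∈ alignedPerms) (sym (agree⇒refill-free π σ (sym lengths) (aligned⇒compatible aligned)))
      (∈-map⁺ (refill π) (∈-permutations⁺ (free π) (filter-↭ (¬? ∘ (_∈? N)) (↭-trans σ∈Sₙ (↭-sym π∈Sₙ)))))
    where open Zipped σ∈Sₙ using (lengths)

  alignedPerms-unique : Unique alignedPerms
  alignedPerms-unique = AllPairs.map⁺ (AllPairs-strengthen refill-injective
    (All.tabulate (∈-permutations⁻ (free π))) (permutations-unique (Unique.filter⁺ (¬? ∘ (_∈? N)) (InS-unique π∈Sₙ))))
    where
    refill-injective : ∀ {q q′} → q ↭ free π → q′ ↭ free π → q ≢ q′ → refill π q ≢ refill π q′
    refill-injective {q} {q′} q↭ q′↭ q≢q′ e = q≢q′ (begin
      q                     ≡⟨ free-refill π q (↭-length q↭) (All-resp-↭ (↭-sym q↭) (free-¬ π)) ⟨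
      free (refill π q)     ≡⟨ cong free e ⟩
      free (refill π q′)    ≡⟨ free-refill π q′ (↭-length q′↭) (All-resp-↭ (↭-sym q′↭) (free-¬ π)) ⟩
      q′                    ∎)
      where open ≡-Reasoning

  length-alignedPerms : 1 ≤ n → length alignedPerms ≡ (n ∸ distinctValues N) !
  length-alignedPerms 1≤n = begin
    length alignedPerms                   ≡⟨ length-map (refill π) (permutations (free π)) ⟩
    length (permutations (free π))        ≡⟨ length-permutations (free π) ⟩
    length (free π) !                     ≡⟨ cong _! length-free ⟩
    (n ∸ distinctValues N) !              ∎
    where
    open ≡-Reasoning
    -- The one use of 1 ≤ n: for n = 0 the necklace consists of the junk value first [] = 0.
    N⊆π : ∀ {a} → a ∈ N → a ∈ π
    N⊆π a∈ with ∈N⁻ a∈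
    ... | k , refl = ∈-resp-↭ (iter-↭ k π)
      (first-∈ (subst (1 ≤_) (sym (trans (↭-length (iter-↭ k π)) (InS-length π∈Sₙ))) 1≤n))
    fixed↭distinct : fixed π ↭ deduplicate _≟_ N
    fixed↭distinct = unique-set-↭ (Unique.filter⁺ (_∈? N) (InS-unique π∈Sₙ)) (deduplicate-! N)
      (λ a∈ → ∈-deduplicate⁺ _≟_ (proj₂ (∈-filter⁻ (_∈? N) {xs = π} a∈)))
      (λ a∈ → let a∈N = ∈-deduplicate⁻ _≟_ N a∈ in ∈-filter⁺ (_∈? N) (N⊆π a∈N) a∈N)
    length-free : length (free π) ≡ n ∸ distinctValues N
    length-free = begin
      length (free π)                                          ≡⟨ m+n∸m≡n (length (fixed π)) _ ⟨
      length (fixed π) + length (free π) ∸ length (fixed π)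
        ≡⟨ cong₂ _∸_ (trans (length-fixed+free π) (InS-length π∈Sₙ)) (↭-length fixed↭distinct) ⟩
      n ∸ distinctValues N                                     ∎

  nthCyc-N : ∀ i → nthCyc N i ≡ entry i
  nthCyc-N i = trans (cong (λ l → nthCyc l i) (firstEntries-applyUpTo π s)) (nthCyc-applyUpTo entry-period i)

  IsPeriod⇒Period : ∀ {u} → IsPeriod N u → Period u entry
  IsPeriod⇒Period {u} per i = trans (sym (nthCyc-N (i + u))) (trans (per i) (nthCyc-N i))

  Period⇒IsPeriod : ∀ {u} → Period u entry → IsPeriod N u
  Period⇒IsPeriod {u} per i = trans (nthCyc-N (i + u)) (trans (per i) (sym (nthCyc-N i)))

  aligned-iter : ∀ {σ k} → Aligned σ → Period k entry → Aligned (iter k σ)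
  aligned-iter {σ} {k} aligned@(σ∈Sₙ , σ-orbit , _) per = ↭-trans (iter-↭ k σ) σ∈Sₙ , OrbitSize-iter σ-orbit k , entries
    where
    entries : firstEntries (iter k σ) s ≡ N
    entries = begin
      firstEntries (iter k σ) s            ≡⟨ firstEntries-applyUpTo (iter k σ) s ⟩
      applyUpTo (firstEntry (iter k σ)) s
        ≡⟨ applyUpTo-cong (λ i → trans (firstEntry-iter σ k i) (trans (aligned-entry aligned (i + k)) (per i))) s ⟩
      applyUpTo entry s                    ≡⟨ firstEntries-applyUpTo π s ⟨
      N                                    ∎
      where open ≡-Reasoning

  sameOrbit⇒period : ∀ {a b} → Aligned a → Aligned b → ∀ {k} → iter k a ≡ b → Period k entry
  sameOrbit⇒period {a} {b} aligned-a aligned-b {k} e i = begin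
    entry (i + k)            ≡⟨ aligned-entry aligned-a (i + k) ⟨
    firstEntry a (i + k)     ≡⟨ firstEntry-iter a k i ⟨
    firstEntry (iter k a) i  ≡⟨ cong (λ σ → firstEntry σ i) e ⟩
    firstEntry b i           ≡⟨ aligned-entry aligned-b i ⟩
    entry i                  ∎
    where open ≡-Reasoning

  necklace-size : ∀ {σ s′ k} → N ≡ rotate k (firstEntries σ s′) → s′ ≡ s
  necklace-size {σ} {s′} {k} N≡ = begin
    s′                                    ≡⟨ length-firstEntries σ s′ ⟨
    length (firstEntries σ s′)            ≡⟨ ↭-length (rotate-↭ k (firstEntries σ s′)) ⟨
    length (rotate k (firstEntries σ s′)) ≡⟨ cong length N≡ ⟨
    length N                              ≡⟨ length-firstEntries π s ⟩
    s                                     ∎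
    where open ≡-Reasoning

  hasNecklace⇒orbitSize : ∀ {σ} → HasNecklace σ N → OrbitSize σ s
  hasNecklace⇒orbitSize {σ} (s′ , σ-orbit , k , N≡) = subst (OrbitSize σ) (necklace-size {σ} {s′} {k} N≡) σ-orbit

  hasNecklace⇒aligned : ∀ {σ} → InS n σ → HasNecklace σ N → ∃ λ k → Aligned (iter k σ)
  hasNecklace⇒aligned {σ} σ∈Sₙ (s′ , σ-orbit , k , N≡) with necklace-size {σ} {s′} {k} N≡
  ... | refl with rotation-realised k σ-orbit N≡
  ...   | k′ , entries = k′ , ↭-trans (iter-↭ k′ σ) σ∈Sₙ , OrbitSize-iter σ-orbit k′ , entries

  aligned⇒hasNecklace : ∀ {σ} → Aligned σ → InS n σ × HasNecklace σ N
  aligned⇒hasNecklace {σ} (σ∈Sₙ , σ-orbit , σ≡) =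
    σ∈Sₙ , s , σ-orbit , 0 , sym (trans (cong (rotate 0) σ≡) (++-identityʳ N))

  module Orbits {t₀ p₀ : ℕ} (least : LeastPeriod N (suc t₀)) (pt≡ : suc p₀ * suc t₀ ≡ length N) where

    t p : ℕ
    t = suc t₀
    p = suc p₀

    pt≡s : p * t ≡ s
    pt≡s = trans pt≡ (length-firstEntries π s)

    t-period : Period t entry
    t-period = IsPeriod⇒Period (proj₁ (proj₂ least))

    t-least : ∀ u → 1 ≤ u → u < t → ¬ Period u entry
    t-least u 1≤u u<t = proj₂ (proj₂ least) u 1≤u u<t ∘ Period⇒IsPeriod

    φ : List ℕ → List ℕ
    φ = iter t

    φ-closed : ∀ {σ} → σ ∈ alignedPerms → φ σ ∈ alignedPerms
    φ-closed σ∈ = ∈-alignedPerms⁺ (aligned-iter (∈-alignedPerms⁻ σ∈) t-period)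

    φ-cyclic : ∀ {σ} → σ ∈ alignedPerms → fold σ φ p ≡ σ
    φ-cyclic {σ} σ∈ with ∈-alignedPerms⁻ σ∈
    ... | _ , (_ , fixed , _) , _ = trans (fold-iter t σ p) (trans (cong (λ m → iter m σ) pt≡s) fixed)

    φ-minimal : ∀ {σ} → σ ∈ alignedPerms → ∀ j → 1 ≤ j → j < p → fold σ φ j ≢ σ
    φ-minimal {σ} σ∈ (suc j) _ j<p e with ∈-alignedPerms⁻ σ∈
    ... | _ , (_ , _ , minimal) , _ =
      minimal (suc j * t) (≤-trans (s≤s z≤n) (m≤m+n t (j * t))) (subst (suc j * t <_) pt≡s (*-monoˡ-< t j<p))
        (trans (sym (fold-iter t σ (suc j))) e)

    module Free = FreeOrbits (≡-dec _≟_) φ p₀ alignedPerms φ-closed φ-cyclic φ-minimal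

    sameOrbit⇒fold : ∀ {a b} → a ∈ alignedPerms → b ∈ alignedPerms → SameOrbit a b → ∃ λ j → fold a φ j ≡ b
    sameOrbit⇒fold {a} a∈ b∈ (k , e)
      with leastPeriod∣period {j = k} t-period t-least (sameOrbit⇒period (∈-alignedPerms⁻ a∈) (∈-alignedPerms⁻ b∈) e)
    ... | divides j refl = j , trans (fold-iter t a j) e

    orbitRepresentatives : 1 ≤ n → Σ (List (List ℕ)) λ reps → OrbitRepresentatives n N reps
                                      × (length reps * p ≡ (n ∸ distinctValues N) !)
    orbitRepresentatives 1≤n with Free.orbitTransversal alignedPerms-unique
    ... | R , T = R , (All.map (aligned⇒hasNecklace ∘ ∈-alignedPerms⁻) ⊆Ys , distinct-orbits , every-orbit)
                    , trans count (length-alignedPerms 1≤n)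
      where
      open Free.Transversal T
      distinct-orbits : AllPairs (λ a b → ¬ SameOrbit a b) R
      distinct-orbits = AllPairs-strengthen (λ a∈ b∈ a≁b → a≁b ∘ sameOrbit⇒fold a∈ b∈) ⊆Ys apart
      every-orbit : ∀ σ → InS n σ → HasNecklace σ N → Any (λ r → SameOrbit r σ) R
      every-orbit σ σ∈Sₙ σ-necklace with hasNecklace⇒aligned σ∈Sₙ σ-necklace
      ... | k , aligned = Any.map sameOrbit (covers (∈-alignedPerms⁺ aligned))
        where
        sameOrbit : ∀ {r} → (∃ λ j → fold r φ j ≡ iter k σ) → SameOrbit r σ
        sameOrbit {r} (j , e) = k * s₀ + j * t , (begin
          iter (k * s₀ + j * t) r         ≡⟨ iter-+ (k * s₀) (j * t) r ⟩
          iter (k * s₀) (iter (j * t) r)  ≡⟨ cong (iter (k * s₀)) (trans (sym (fold-iter t r j)) e) ⟩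
          iter (k * s₀) (iter k σ)        ≡⟨ iter-undo (proj₁ (proj₂ (hasNecklace⇒orbitSize σ-necklace))) k ⟩
          σ                               ∎)
          where open ≡-Reasoning

  orbitCount : 1 ≤ n → ∀ p → FundamentalPeriod N p →
               Σ (List (List ℕ)) λ reps → OrbitRepresentatives n N reps × (length reps * p ≡ (n ∸ distinctValues N) !)
  orbitCount 1≤n (suc p₀) (suc t₀ , least , pt≡) = Orbits.orbitRepresentatives least pt≡ 1≤n
  orbitCount _ _ (zero , (() , _) , _)
  orbitCount _ zero (suc t₀ , _ , ())

theorem4p1 : (n : ℕ) → 1 ≤ n → (N : List ℕ) → ValidNecklace n N →
    (p : ℕ) → FundamentalPeriod N p →
    Σ (List (List ℕ)) λ reps → OrbitRepresentatives n N reps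
    × (length reps * p ≡ (n ∸ distinctValues N) !)
theorem4p1 n 1≤n N (π₀ , π₀∈Sₙ , zero , (() , _) , _) _ _
theorem4p1 n 1≤n N (π₀ , π₀∈Sₙ , suc s₀ , π₀-orbit , k , N≡) p fundamental
  with rotation-realised k π₀-orbit N≡
... | k′ , refl = orbitCount 1≤n p fundamental
  where open AlignedWith (↭-trans (iter-↭ k′ π₀) π₀∈Sₙ) (OrbitSize-iter π₀-orbit k′)
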